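{- The triple $\mathscr{D}=(D,\mathcal{A},\lambda)$ defined in the context is an extensional categorical model of the differential $\lambda$-calculus in $\mathbf{MRel}$: $\lambda\circ\mathcal{A}=\mathrm{Id}_D$, $\mathcal{A}\circ\lambda=\mathrm{Id}_{[D\Rightarrow D]}$, and both $\mathcal{A}$ and $\lambda$ are linear.
   Context: $\mathbf{MRel}$: objects are sets; $\mathbf{MRel}(A,B)=\mathcal{P}(\mathcal{M}_f(A)\times B)$ with $\mathcal{M}_f(A)$ the finite multisets over $A$; identity $\{([\alpha],\alpha)\}$; composition $t\circ s=\{(m,\gamma)\mid\exists(m_1,\beta_1),\dots,(m_k,\beta_k)\in s,\ m=m_1\uplus\cdots\uplus m_k,\ ([\beta_1,\dots,\beta_k],\gamma)\in t\}$; product $A\&A'$ is disjoint union with $\mathcal{M}_f(A\&A')\cong\mathcal{M}_f(A)\times\mathcal{M}_f(A')$, projections $\pi_i=\{([(i,a)],a)\}$; exponential $[A\Rightarrow B]=\mathcal{M}_f(A)\times B$; derivative $D(f)=\{(([\alpha],m),\beta)\mid(m\uplus[\alpha],\beta)\in f\}$; $f$ is linear iff $D(f)=f\circ\pi_1$. A sequence $(m_1,m_2,\dots)$ of finite multisets indexed by positive integers is quasi-finite if $m_i=[]$ for all but finitely many $i$; $\mathcal{M}_f(X)^{(\omega)}$ is the set of quasi-finite sequences of finite multisets over $X$. Set $D_0=\emptyset$, $D_{n+1}=\mathcal{M}_f(D_n)^{(\omega)}$, $D=\bigcup_n D_n$. For $m\in\mathcal{M}_f(D)$ and $\sigma=(\sigma_1,\sigma_2,\dots)\in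 D$, $m::\sigma=(m,\sigma_1,\sigma_2,\dots)\in D$. Then $\lambda=\{([(m,\sigma)],m::\sigma)\mid m\in\mathcal{M}_f(D),\sigma\in D\}\in\mathbf{MRel}([D\Rightarrow D],D)$ and $\mathcal{A}=\{([m::\sigma],(m,\sigma))\mid m\in\mathcal{M}_f(D),\sigma\in D\}\in\mathbf{MRel}(D,[D\Rightarrow D])$. An extensional categorical model of the differential $\lambda$-calculus is a triple $(U,\mathcal{A},\lambda)$ in a Cartesian closed differential category with $\mathcal{A}:U\to[U\Rightarrow U]$, $\lambda:[U\Rightarrow U]\to U$ mutually inverse and both linear. -}

module Defs where

open import Level using (0ℓ)
open import Data.Nat using (ℕ; zero; suc)
open import Data.List using (List; []; _∷_; _++_; concat; map; [_])
open import Data.List.Relation.Unary.All using (All)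
open import Data.List.Relation.Binary.Permutation.Homogeneous using (Permutation)
open import Data.Product using (Σ; _×_; _,_; proj₁; proj₂; uncurry)
open import Data.Sum using (_⊎_; inj₁; inj₂)
open import Data.Sum.Relation.Binary.Pointwise using (Pointwise)
import Data.Product.Relation.Binary.Pointwise.NonDependent as ×P
open import Function.Bundles using (_⇔_)
open import Relation.Binary.Core using (Rel)

-- Objects of MRel: sets, presented as a carrier type together with the
-- equality relation of the set (needed because finite multisets and
-- the domain D are represented by lists up to an equivalence).

record Obj : Set₁ where
  field
    Carrier : Set
    _≈_     : Rel Carrier 0ℓ
open Obj public

Mf : Obj → Set
Mf A = List (Carrier A)

MfObj : Obj → Obj
MfObj A = record { Carrier = Mf A ; _≈_ = Permutation (_≈_ A) }

MRel : Obj → Obj → Set₁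
MRel A B = Mf A → Carrier B → Set

Eqᴹ : (A B : Obj) → MRel A B → MRel A B → Set
Eqᴹ A B f g = (m : Mf A) (b : Carrier B) → f m b ⇔ g m b

Id : (A : Obj) → MRel A A
Id A m a = Permutation (_≈_ A) m [ a ]

_∘ᴹ_ : {A B C : Obj} → MRel B C → MRel A B → MRel A C
_∘ᴹ_ {A} {B} {C} t s m γ =
  Σ (List (Mf A × Carrier B)) λ ps →
    All (uncurry s) ps
    × Permutation (_≈_ A) m (concat (map proj₁ ps))
    × t (map proj₂ ps) γ

_&_ : Obj → Obj → Obj
A & A' = record { Carrier = Carrier A ⊎ Carrier A'
                ; _≈_ = Pointwise (_≈_ A) (_≈_ A') }

π₁ : (A A' : Obj) → MRel (A & A') A
π₁ A A' m a = Permutation (_≈_ (A & A')) m [ inj₁ a ]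

_⇒_ : Obj → Obj → Obj
A ⇒ B = record { Carrier = Mf A × Carrier B
               ; _≈_ = ×P.Pointwise (Permutation (_≈_ A)) (_≈_ B) }

-- differential D(f) = {(([α],m),β) | (m ⊎ [α], β) ∈ f}, using the
-- isomorphism M_f(A & A) ≅ M_f(A) × M_f(A): the multiset
-- [inj₁ α] ⊎ map inj₂ m over A & A corresponds to ([α], m).
Dif : {A B : Obj} → MRel A B → MRel (A & A) B
Dif {A} {B} f n β =
  Σ (Carrier A) λ α → Σ (Mf A) λ m →
    Permutation (_≈_ (A & A)) n (inj₁ α ∷ map inj₂ m)
    × f (m ++ [ α ]) β

Linear : {A B : Obj} → MRel A B → Set
Linear {A} {B} f = Eqᴹ (A & A) B (Dif {A} {B} f) (_∘ᴹ_ {A & A} {A} {B} f (π₁ A A))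

record ExtensionalModel (U : Obj) (app : MRel U (U ⇒ U)) (lam : MRel (U ⇒ U) U) : Set where
  field
    lam∘app : Eqᴹ U U (_∘ᴹ_ {U} {U ⇒ U} {U} lam app) (Id U)
    app∘lam : Eqᴹ (U ⇒ U) (U ⇒ U) (_∘ᴹ_ {U ⇒ U} {U} {U ⇒ U} app lam) (Id (U ⇒ U))
    app-linear : Linear {U} {U ⇒ U} app
    lam-linear : Linear {U ⇒ U} {U} lam

-- The domain D = ⋃ D_n, D_0 = ∅, D_{n+1} = M_f(D_n)^(ω).
-- An element is a quasi-finite sequence of finite multisets, represented
-- by a finite list (the remaining entries being []).  Every element of
-- the inductive type below has finite depth, so it lies in some D_n.

data Dom : Set where
  seq : List (List Dom) → Dom

entry : List (List Dom) → ℕ → List Dom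
entry []       _       = []
entry (m ∷ xs) zero    = m
entry (m ∷ xs) (suc i) = entry xs i

data _≈D_ : Dom → Dom → Set where
  seq≈ : ∀ {xs ys} →
         ((i : ℕ) → Permutation _≈D_ (entry xs i) (entry ys i)) →
         seq xs ≈D seq ys

Dᴼ : Obj
Dᴼ = record { Carrier = Dom ; _≈_ = _≈D_ }

_∷ˢ_ : List Dom → Dom → Dom
m ∷ˢ seq xs = seq (m ∷ xs)

lamD : MRel (Dᴼ ⇒ Dᴼ) Dᴼ
lamD n τ = Σ (List Dom × Dom) λ p →
  Permutation (_≈_ (Dᴼ ⇒ Dᴼ)) n [ p ] × τ ≈D (proj₁ p ∷ˢ proj₂ p)

appD : MRel Dᴼ (Dᴼ ⇒ Dᴼ)
appD n (m , σ) = Permutation _≈D_ n [ m ∷ˢ σ ]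

-- 𝒜 and λ relate only singleton multisets to points, and every morphism of
-- MRel with this property is linear: if m ⊎ [α] is a singleton then m = [],
-- so D(f) and f ∘ π₁ contain the same pairs.  Composing two such morphisms is
-- composing the underlying relations, so 𝒜 and λ are mutually inverse because
-- (m , σ) ↦ m :: σ is a bijection M_f(D) × D → D up to the equality of D:
-- it is injective entrywise, and surjective since the empty sequence is
-- [] :: [].
module Submission where

open import Defs

open import Level using (0ℓ)
open import Data.Nat using (zero; suc)
open import Data.Nat.Properties using (suc-injective; m+1+n≢0)
open import Data.List using (List; []; _∷_; _++_; [_]; length)
open import Data.List.Properties using (length-++; ++-identityʳ)
open import Data.List.Relation.Unary.All using ([]; _∷_)
open import Data.List.Relation.Unary.Any using (here)
open import Data.List.Relation.Unary.Any.Properties using (singleton⁻)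
open import Data.List.Relation.Binary.Pointwise.Base using (Pointwise; []; _∷_)
import Data.List.Relation.Binary.Pointwise.Properties as Pointwise
open import Data.List.Relation.Binary.Permutation.Homogeneous
  using (Permutation; refl; prep; swap; trans; onIndices)
import Data.List.Relation.Binary.Permutation.Setoid as PermutationSetoid
import Data.List.Relation.Binary.Permutation.Setoid.Properties as PermutationProperties
open import Data.Fin.Permutation using (↔⇒≡)
open import Data.Product using (Σ; ∃₂; _×_; _,_; uncurry′)
open import Data.Product.Relation.Binary.Pointwise.NonDependent using (×-setoid)
open import Data.Sum.Relation.Binary.Pointwise using (⊎-refl)
open import Function using (_∘_)
open import Function.Bundles using (_⇔_; mk⇔; module Equivalence)
open import Relation.Binary.Bundles using (Setoid)
open import Relation.Binary.Core using (Rel)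
open import Relation.Binary.Definitions using (Reflexive; Symmetric)
open import Relation.Binary.PropositionalEquality using (_≡_; sym; subst)
  renaming (refl to ≡-refl; trans to ≡-trans)
open import Relation.Nullary using (contradiction)

↭-length : ∀ {A : Set} {R : Rel A 0ℓ} {xs ys} →
           Permutation R xs ys → length xs ≡ length ys
↭-length = ↔⇒≡ ∘ onIndices

|xs++[x]|≡1⇒xs≡[] : ∀ {A : Set} (xs : List A) {x} → length (xs ++ [ x ]) ≡ 1 → xs ≡ []
|xs++[x]|≡1⇒xs≡[] []       _  = ≡-refl
|xs++[x]|≡1⇒xs≡[] (_ ∷ xs) eq =
  contradiction (≡-trans (sym (length-++ xs)) (suc-injective eq)) (m+1+n≢0 (length xs))

module _ {S : Setoid 0ℓ 0ℓ} where
  open Setoid S using () renaming (_≈_ to _≈ₛ_; refl to ≈-refl)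
  open PermutationSetoid S using (_↭_)
  open PermutationProperties S using (∈-resp-↭)

  [x]↭[y]⇒x≈y : ∀ {x y} → [ x ] ↭ [ y ] → x ≈ₛ y
  [x]↭[y]⇒x≈y x↭y = singleton⁻ (∈-resp-↭ x↭y (here ≈-refl))

Singular : (A B : Obj) → MRel A B → Set
Singular A B f = ∀ {m b} → f m b → length m ≡ 1

module _ {A B C : Obj} {f : MRel A B} {g : MRel B C} where

  ∘-singular : Singular B C g → ∀ {m c} →
               (_∘ᴹ_ {A} {B} {C} g f) m c ⇔
               ∃₂ λ m₁ b → Permutation (_≈_ A) m m₁ × f m₁ b × g [ b ] c
  ∘-singular g-singular {m} = mk⇔ to from
    where
    to : ∀ {c} → (_∘ᴹ_ {A} {B} {C} g f) m c →
         ∃₂ λ m₁ b → Permutation (_≈_ A) m m₁ × f m₁ b × g [ b ] c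
    to ((m₁ , b) ∷ [] , fm₁b ∷ [] , m↭m₁++[] , gbc) =
      m₁ , b , subst (Permutation _ m) (++-identityʳ m₁) m↭m₁++[] , fm₁b , gbc
    to ([]        , _ , _ , g[]c) = contradiction (g-singular g[]c) λ ()
    to (_ ∷ _ ∷ _ , _ , _ , gbsc) = contradiction (g-singular gbsc) λ ()

    from : ∀ {c} → (∃₂ λ m₁ b → Permutation (_≈_ A) m m₁ × f m₁ b × g [ b ] c) →
           (_∘ᴹ_ {A} {B} {C} g f) m c
    from (m₁ , b , m↭m₁ , fm₁b , gbc) =
      [ (m₁ , b) ] , fm₁b ∷ [] , subst (Permutation _ m) (sym (++-identityʳ m₁)) m↭m₁ , gbc

module _ {A B : Obj} {f : MRel A B} where

  singular⇒linear : Reflexive (_≈_ A) → Singular A B f → Linear {A} {B} f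
  singular⇒linear ≈-refl f-singular n β = mk⇔ to from
    where
    ↭-refl : Reflexive (Permutation (_≈_ (A & A)))
    ↭-refl = refl (Pointwise.refl (⊎-refl ≈-refl ≈-refl))

    to : Dif {A} {B} f n β → (_∘ᴹ_ {A & A} {A} {B} f (π₁ A A)) n β
    to (α , m , n↭ , fmα) with ≡-refl ← |xs++[x]|≡1⇒xs≡[] m (f-singular fmα) =
      ∘-singular {A & A} {A} {B} {π₁ A A} {f} f-singular .Equivalence.from
        (n , α , ↭-refl , n↭ , fmα)

    from : (_∘ᴹ_ {A & A} {A} {B} f (π₁ A A)) n β → Dif {A} {B} f n β
    from c with n₁ , α , n↭n₁ , n₁↭α , fα ←
                ∘-singular {A & A} {A} {B} {π₁ A A} {f} f-singular .Equivalence.to c =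
      α , [] , trans n↭n₁ n₁↭α , fα

mutual
  ≈D-refl : Reflexive _≈D_
  ≈D-refl {seq xs} = seq≈ (entries-refl xs)

  entries-refl : ∀ xs i → Permutation _≈D_ (entry xs i) (entry xs i)
  entries-refl []       _       = refl []
  entries-refl (m ∷ _)  zero    = refl (pointwise-refl m)
  entries-refl (_ ∷ xs) (suc i) = entries-refl xs i

  pointwise-refl : ∀ m → Pointwise _≈D_ m m
  pointwise-refl []      = []
  pointwise-refl (_ ∷ m) = ≈D-refl ∷ pointwise-refl m

mutual
  ≈D-sym : Symmetric _≈D_
  ≈D-sym (seq≈ xs≈ys) = seq≈ (↭D-sym ∘ xs≈ys)

  ↭D-sym : Symmetric (Permutation _≈D_)
  ↭D-sym (refl xs≈ys)       = refl (pointwise-sym xs≈ys)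
  ↭D-sym (prep x≈y p)       = prep (≈D-sym x≈y) (↭D-sym p)
  ↭D-sym (swap x≈x′ y≈y′ p) = swap (≈D-sym y≈y′) (≈D-sym x≈x′) (↭D-sym p)
  ↭D-sym (trans p q)        = trans (↭D-sym q) (↭D-sym p)

  pointwise-sym : Symmetric (Pointwise _≈D_)
  pointwise-sym []            = []
  pointwise-sym (x≈y ∷ xs≈ys) = ≈D-sym x≈y ∷ pointwise-sym xs≈ys

≈D-trans : ∀ {x y z} → x ≈D y → y ≈D z → x ≈D z
≈D-trans (seq≈ xs≈ys) (seq≈ ys≈zs) = seq≈ λ i → trans (xs≈ys i) (ys≈zs i)

D-setoid : Setoid 0ℓ 0ℓ
D-setoid = record
  { Carrier       = Dom
  ; _≈_           = _≈D_
  ; isEquivalence = record { refl = ≈D-refl ; sym = ≈D-sym ; trans = ≈D-trans }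
  }

D⇒D-setoid : Setoid 0ℓ 0ℓ
D⇒D-setoid = ×-setoid (PermutationSetoid.↭-setoid D-setoid) D-setoid

open PermutationSetoid D-setoid using () renaming (↭-refl to ↭D-refl)
open PermutationSetoid D⇒D-setoid using () renaming (↭-refl to ↭D⇒D-refl)
open Setoid D⇒D-setoid using () renaming (refl to ≈D⇒D-refl)

∷ˢ-cong : ∀ {a b σ τ} → Permutation _≈D_ a b → σ ≈D τ → (a ∷ˢ σ) ≈D (b ∷ˢ τ)
∷ˢ-cong {σ = seq _} {τ = seq _} a↭b (seq≈ σ≈τ) = seq≈ λ where
  zero    → a↭b
  (suc i) → σ≈τ i

∷ˢ-injective : ∀ {a b σ τ} → (a ∷ˢ σ) ≈D (b ∷ˢ τ) → Permutation _≈D_ a b × σ ≈D τ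
∷ˢ-injective {σ = seq _} {τ = seq _} (seq≈ aσ≈bτ) = aσ≈bτ zero , seq≈ (aσ≈bτ ∘ suc)

∷ˢ-surjective : ∀ γ → Σ (List Dom × Dom) λ (a , σ) → γ ≈D (a ∷ˢ σ)
∷ˢ-surjective (seq [])       = ([] , seq []) , seq≈ λ where
  zero    → refl []
  (suc _) → refl []
∷ˢ-surjective (seq (m ∷ xs)) = (m , seq xs) , ≈D-refl

appD-singular : Singular Dᴼ (Dᴼ ⇒ Dᴼ) appD
appD-singular = ↭-length

lamD-singular : Singular (Dᴼ ⇒ Dᴼ) Dᴼ lamD
lamD-singular (_ , n↭[p] , _) = ↭-length n↭[p]

lamD∘appD≈Id : Eqᴹ Dᴼ Dᴼ (_∘ᴹ_ {Dᴼ} {Dᴼ ⇒ Dᴼ} {Dᴼ} lamD appD) (Id Dᴼ)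
lamD∘appD≈Id m γ = mk⇔ to from
  where
  open Equivalence (∘-singular {Dᴼ} {Dᴼ ⇒ Dᴼ} {Dᴼ} {appD} {lamD} lamD-singular {m} {γ})
    renaming (to to decompose; from to compose)

  to : (_∘ᴹ_ {Dᴼ} {Dᴼ ⇒ Dᴼ} {Dᴼ} lamD appD) m γ → Id Dᴼ m γ
  to c with m₁ , (a , σ) , m↭m₁ , m₁↭[aσ] , _ , [aσ]↭[p] , γ≈p ← decompose c =
    trans m↭m₁ (trans m₁↭[aσ] (refl (aσ≈γ ∷ [])))
    where
    aσ≈γ : (a ∷ˢ σ) ≈D γ
    aσ≈γ = ≈D-trans (uncurry′ ∷ˢ-cong ([x]↭[y]⇒x≈y {D⇒D-setoid} [aσ]↭[p])) (≈D-sym γ≈p)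

  from : Id Dᴼ m γ → (_∘ᴹ_ {Dᴼ} {Dᴼ ⇒ Dᴼ} {Dᴼ} lamD appD) m γ
  from m↭[γ] with aσ , γ≈aσ ← ∷ˢ-surjective γ =
    compose (m , aσ , ↭D-refl , trans m↭[γ] (refl (γ≈aσ ∷ [])) , aσ , ↭D⇒D-refl , γ≈aσ)

appD∘lamD≈Id : Eqᴹ (Dᴼ ⇒ Dᴼ) (Dᴼ ⇒ Dᴼ) (_∘ᴹ_ {Dᴼ ⇒ Dᴼ} {Dᴼ} {Dᴼ ⇒ Dᴼ} appD lamD) (Id (Dᴼ ⇒ Dᴼ))
appD∘lamD≈Id n (a , σ) = mk⇔ to from
  where
  open Equivalence (∘-singular {Dᴼ ⇒ Dᴼ} {Dᴼ} {Dᴼ ⇒ Dᴼ} {lamD} {appD} appD-singular {n} {a , σ})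
    renaming (to to decompose; from to compose)

  to : (_∘ᴹ_ {Dᴼ ⇒ Dᴼ} {Dᴼ} {Dᴼ ⇒ Dᴼ} appD lamD) n (a , σ) → Id (Dᴼ ⇒ Dᴼ) n (a , σ)
  to c with n₁ , _ , n↭n₁ , ((b , ρ) , n₁↭[p] , τ≈p) , [τ]↭[aσ] ← decompose c =
    trans n↭n₁ (trans n₁↭[p] (refl (p≈aσ ∷ [])))
    where
    p≈aσ : Permutation _≈D_ b a × ρ ≈D σ
    p≈aσ = ∷ˢ-injective (≈D-trans (≈D-sym τ≈p) ([x]↭[y]⇒x≈y {D-setoid} [τ]↭[aσ]))

  from : Id (Dᴼ ⇒ Dᴼ) n (a , σ) → (_∘ᴹ_ {Dᴼ ⇒ Dᴼ} {Dᴼ} {Dᴼ ⇒ Dᴼ} appD lamD) n (a , σ)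
  from n↭[aσ] = compose (n , a ∷ˢ σ , ↭D⇒D-refl , ((a , σ) , n↭[aσ] , ≈D-refl) , ↭D-refl)

proposition5p7 : ExtensionalModel Dᴼ appD lamD
proposition5p7 = record
  { lam∘app    = lamD∘appD≈Id
  ; app∘lam    = appD∘lamD≈Id
  ; app-linear = singular⇒linear {Dᴼ} {Dᴼ ⇒ Dᴼ} {appD} ≈D-refl appD-singular
  ; lam-linear = singular⇒linear {Dᴼ ⇒ Dᴼ} {Dᴼ} {lamD} ≈D⇒D-refl lamD-singular
  }
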